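{- For every natural number $l<\omega$ the language $L_{\le l}=\{x\in\mathrm{Tr}_{\{0,1\}}\mid x\text{ is well-founded and }\mathrm{rank}(x)\le l\}$ is regular.
   Context: $\mathrm{Tr}_{\{0,1\}}$ is the set of maps $x\colon\{\mathtt{L},\mathtt{R}\}^*\to\{0,1\}$ (labellings of the full binary tree). $x$ is well-founded if no infinite branch contains infinitely many nodes labelled $1$; $\mathrm{rank}(x)$ is the least ordinal $\eta$ admitting a map $C$ from the $1$-labelled nodes to $\eta$ with $C(u)<C(v)$ whenever $u$ is a proper descendant of $v$. A language of trees is regular if it is recognised by a nondeterministic parity tree automaton (equivalently, is MSO-definable). -}

module Defs where

open import Data.Nat using (ℕ; zero; suc; _≤_)
open import Data.Nat.Properties using ()
open import Data.Nat using (_%_)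
open import Data.Bool using (Bool; true; false)
open import Data.Fin using (Fin) renaming (_<_ to _<ᶠ_)
open import Data.List using (List; []; _∷_; _++_; _∷ʳ_)
open import Data.Product using (Σ; ∃; ∃-syntax; _×_; _,_)
open import Data.Empty using (⊥)
open import Relation.Nullary using (¬_)
open import Relation.Binary.PropositionalEquality using (_≡_)
open import Function.Bundles using (_⇔_)

-- Directions and nodes of the full binary tree {L,R}^*.
-- A node is the word of directions from the root (first letter = first step).
data Dir : Set where
  L R : Dir

Node : Set
Node = List Dir

-- Tr_{0,1}: labellings of the full binary tree; label 1 is 'true', 0 is 'false'.
Tree : Set
Tree = Node → Bool

ProperDesc : Node → Node → Set
ProperDesc u v = Σ Dir λ d → Σ Node λ w → u ≡ v ++ (d ∷ w)

Branch : Set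
Branch = ℕ → Dir

prefix : Branch → ℕ → Node
prefix β zero    = []
prefix β (suc n) = prefix β n ∷ʳ β n

InfOften : (ℕ → Set) → Set
InfOften P = ∀ n → Σ ℕ λ m → n ≤ m × P m

Eventually : (ℕ → Set) → Set
Eventually P = Σ ℕ λ n → ∀ m → n ≤ m → P m

WellFounded : Tree → Set
WellFounded x = ∀ (β : Branch) → ¬ InfOften (λ m → x (prefix β m) ≡ true)

-- A rank witness into η = l (ordinal l = {0,…,l-1} = Fin l):
-- a map from 1-labelled nodes to l, strictly decreasing along proper descendants.
RankMap : Tree → ℕ → Set
RankMap x l =
  Σ ((u : Node) → x u ≡ true → Fin l) λ C →
    ∀ u v (pu : x u ≡ true) (pv : x v ≡ true) →
      ProperDesc u v → C u pu <ᶠ C v pv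

-- rank(x) ≤ l. Since rank(x) is the least ordinal η admitting such a map,
-- rank(x) ≤ l iff some η ≤ l admits a map, iff l itself admits one
-- (maps into η ⊆ l are maps into l).
RankLe : Tree → ℕ → Set
RankLe x l = RankMap x l

InL≤ : ℕ → Tree → Set
InL≤ l x = WellFounded x × RankLe x l

record ParityTreeAutomaton : Set where
  field
    nStates  : ℕ
    initial  : Fin nStates
    δ        : Fin nStates → Bool → Fin nStates → Fin nStates → Bool
    priority : Fin nStates → ℕ

open ParityTreeAutomaton public

Even : ℕ → Set
Even p = p % 2 ≡ 0

record Run (A : ParityTreeAutomaton) (x : Tree) : Set where
  field
    ρ       : Node → Fin (nStates A)
    root    : ρ [] ≡ initial A
    trans   : ∀ u → δ A (ρ u) (x u) (ρ (u ∷ʳ L)) (ρ (u ∷ʳ R)) ≡ true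

open Run public

AcceptingRun : (A : ParityTreeAutomaton) (x : Tree) → Run A x → Set
AcceptingRun A x r =
  ∀ (β : Branch) → Σ ℕ λ p → Even p ×
    InfOften (λ m → priority A (ρ r (prefix β m)) ≡ p) ×
    Eventually (λ m → priority A (ρ r (prefix β m)) ≤ p)

Accepts : ParityTreeAutomaton → Tree → Set
Accepts A x = Σ (Run A x) λ r → AcceptingRun A x r

Regular : (Tree → Set) → Set
Regular Lang = Σ ParityTreeAutomaton λ A → ∀ x → Accepts A x ⇔ Lang x

-- A tree is in L_{≤l} exactly when every path from the root meets at most l nodes labelled 1:
-- a rank map into l strictly decreases along the 1s of a path, so it bounds their number by l;
-- conversely such a bound rules out infinitely many 1s on a branch, and u ↦ l − 1 − (number of
-- 1s strictly above u) is a rank map. This bound is checked by a deterministic automaton whose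
-- states 0, …, l count the 1s seen so far and which has no transition once the count exceeds l.
module Submission where

open import Defs
open import Data.Nat using (ℕ; zero; suc; _+_; _∸_; _≤_; _<_; _≤′_; ≤′-refl; ≤′-step; _≡ᵇ_; z≤n; s≤s; z<s)
open import Data.Nat.Properties
  using (≤-refl; ≤-trans; ≤-pred; +-monoʳ-≤; +-comm; +-assoc; m<m+n; ∸-monoʳ-<; <⇒≱; ≤⇒≤′;
         ≡ᵇ⇒≡; ≡⇒≡ᵇ; module ≤-Reasoning)
open import Data.Bool using (Bool; true; false; _∧_)
open import Data.Bool.Properties using (T-≡; T-∧)
open import Data.Fin using (Fin; toℕ; fromℕ<) renaming (zero to fzero)
open import Data.Fin.Properties using (toℕ-fromℕ<; toℕ<n)
open import Data.List using ([]; _∷_; _++_; _∷ʳ_)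
open import Data.List.Properties using (++-assoc)
open import Data.List.Reverse using (Reverse; []; _∶_∶ʳ_; reverseView)
open import Data.Product using (Σ; _×_; _,_; proj₁; proj₂)
open import Relation.Binary.PropositionalEquality
  using (_≡_; refl; sym; cong; subst; subst₂; module ≡-Reasoning)
open import Function.Bundles using (mk⇔; Equivalence)

open Equivalence using (to; from)

bit : Bool → ℕ
bit true  = 1
bit false = 0

subtree : Tree → Node → Tree
subtree x v w = x (v ++ w)

onesAbove : Tree → Node → ℕ
onesAbove x []      = 0
onesAbove x (d ∷ u) = bit (x []) + onesAbove (subtree x (d ∷ [])) u

onesAbove-∷ʳ : ∀ x u d → onesAbove x (u ∷ʳ d) ≡ onesAbove x u + bit (x u)
onesAbove-∷ʳ x []      d = +-comm (bit (x [])) 0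
onesAbove-∷ʳ x (e ∷ u) d = begin
  bit (x []) + onesAbove (subtree x (e ∷ [])) (u ∷ʳ d)
    ≡⟨ cong (bit (x []) +_) (onesAbove-∷ʳ (subtree x (e ∷ [])) u d) ⟩
  bit (x []) + (onesAbove (subtree x (e ∷ [])) u + bit (x (e ∷ u)))
    ≡⟨ +-assoc (bit (x [])) _ _ ⟨
  onesAbove x (e ∷ u) + bit (x (e ∷ u)) ∎
  where open ≡-Reasoning

onesAbove-mono-++ : ∀ x u w → onesAbove x u ≤ onesAbove x (u ++ w)
onesAbove-mono-++ x []      w = z≤n
onesAbove-mono-++ x (d ∷ u) w = +-monoʳ-≤ (bit (x [])) (onesAbove-mono-++ (subtree x (d ∷ [])) u w)

onesAbove-desc : ∀ x v d w → x v ≡ true → onesAbove x v < onesAbove x (v ++ d ∷ w)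
onesAbove-desc x v d w xv≡1 = begin-strict
  onesAbove x v                  <⟨ subst (λ b → onesAbove x v < onesAbove x v + bit b)
                                          (sym xv≡1) (m<m+n _ z<s) ⟩
  onesAbove x v + bit (x v)      ≡⟨ onesAbove-∷ʳ x v d ⟨
  onesAbove x (v ∷ʳ d)           ≤⟨ onesAbove-mono-++ x (v ∷ʳ d) w ⟩
  onesAbove x ((v ∷ʳ d) ++ w)    ≡⟨ cong (onesAbove x) (++-assoc v (d ∷ []) w) ⟩
  onesAbove x (v ++ d ∷ w)       ∎
  where open ≤-Reasoning

onesAbove-prefix-mono : ∀ x β {m n} → m ≤′ n →
                        onesAbove x (prefix β m) ≤ onesAbove x (prefix β n)
onesAbove-prefix-mono x β ≤′-refl                = ≤-refl
onesAbove-prefix-mono x β (≤′-step {n} m≤′n) =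
  ≤-trans (onesAbove-prefix-mono x β m≤′n) (onesAbove-mono-++ x (prefix β n) (β n ∷ []))

onesAbove-prefix-unbounded : ∀ x β → InfOften (λ m → x (prefix β m) ≡ true) →
                             ∀ k → Σ ℕ λ m → k ≤ onesAbove x (prefix β m)
onesAbove-prefix-unbounded x β inf zero    = 0 , z≤n
onesAbove-prefix-unbounded x β inf (suc k) with onesAbove-prefix-unbounded x β inf k
... | m , k≤ones with inf m
... | m′ , m≤m′ , x≡1 = suc m′ , ≤-trans (s≤s k≤ones)
        (≤-trans (s≤s (onesAbove-prefix-mono x β (≤⇒≤′ m≤m′)))
                 (onesAbove-desc x (prefix β m′) (β m′) [] x≡1))

-- Bounding only the 1s strictly above each node suffices: those of u are above u ∷ʳ L.
OnesBounded : ℕ → Tree → Set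
OnesBounded l x = ∀ u → onesAbove x u ≤ l

bounded⇒wellFounded : ∀ {l x} → OnesBounded l x → WellFounded x
bounded⇒wellFounded {l} {x} bounded β inf =
  let m , l<ones = onesAbove-prefix-unbounded x β inf (suc l)
  in <⇒≱ l<ones (bounded (prefix β m))

rankMap-fromℕ : ∀ {x l} (c : ∀ u → x u ≡ true → ℕ) → (∀ u p → c u p < l) →
                (∀ u v pu pv → ProperDesc u v → c u pu < c v pv) → RankMap x l
rankMap-fromℕ c c<l c-desc =
  (λ u p → fromℕ< (c<l u p)) ,
  λ u v pu pv u<v → subst₂ _<_ (sym (toℕ-fromℕ< _)) (sym (toℕ-fromℕ< _)) (c-desc u v pu pv u<v)

bounded⇒rankMap : ∀ {l x} → OnesBounded l x → RankMap x l
bounded⇒rankMap {l} {x} bounded =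
  rankMap-fromℕ (λ u _ → l ∸ suc (onesAbove x u)) rank<l rank-desc
  where
  ones<l : ∀ u → x u ≡ true → onesAbove x u < l
  ones<l u xu≡1 = ≤-trans (onesAbove-desc x u L [] xu≡1) (bounded (u ∷ʳ L))

  rank<l : ∀ u → x u ≡ true → l ∸ suc (onesAbove x u) < l
  rank<l u xu≡1 = ∸-monoʳ-< z<s (ones<l u xu≡1)

  rank-desc : ∀ u v → x u ≡ true → x v ≡ true → ProperDesc u v →
              l ∸ suc (onesAbove x u) < l ∸ suc (onesAbove x v)
  rank-desc u v xu≡1 xv≡1 (d , w , refl) =
    ∸-monoʳ-< (s≤s (onesAbove-desc x v d w xv≡1)) (ones<l u xu≡1)

rankMap-child : ∀ {x l k} d ((C , _) : RankMap x l) → (∀ u p → toℕ (C (d ∷ u) p) < k) →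
                RankMap (subtree x (d ∷ [])) k
rankMap-child d (C , C-desc) C<k =
  rankMap-fromℕ (λ u p → toℕ (C (d ∷ u) p)) C<k
    (λ u v pu pv (e , w , u≡v++ew) → C-desc (d ∷ u) (d ∷ v) pu pv (e , w , cong (d ∷_) u≡v++ew))

rankMap⇒bounded : ∀ {l x} → RankMap x l → OnesBounded l x
rankMap⇒bounded rank []      = z≤n
rankMap⇒bounded {x = x} rank@(C , C-desc) (d ∷ u) with x [] in x[]≡b
... | false = rankMap⇒bounded (rankMap-child d rank (λ v p → toℕ<n (C (d ∷ v) p))) u
... | true  =
  ≤-trans (s≤s (rankMap⇒bounded (rankMap-child d rank below-root) u)) (toℕ<n (C [] x[]≡b))
  where
  below-root : ∀ v p → toℕ (C (d ∷ v) p) < toℕ (C [] x[]≡b)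
  below-root v p = C-desc (d ∷ v) [] p x[]≡b (d , v , refl)

-- The count cannot exceed l because Fin (suc l) has no state to hold it, so no explicit
-- check is needed; all priorities are 0, so every run is accepting.
counterδ : (l : ℕ) → Fin (suc l) → Bool → Fin (suc l) → Fin (suc l) → Bool
counterδ l q b q₁ q₂ = (toℕ q₁ ≡ᵇ toℕ q + bit b) ∧ (toℕ q₂ ≡ᵇ toℕ q + bit b)

onesCounter : ℕ → ParityTreeAutomaton
onesCounter l = record { nStates = suc l ; initial = fzero ; δ = counterδ l ; priority = λ _ → 0 }

counterδ-sound : ∀ {l} q b q₁ q₂ → counterδ l q b q₁ q₂ ≡ true →
                 toℕ q₁ ≡ toℕ q + bit b × toℕ q₂ ≡ toℕ q + bit b
counterδ-sound q b q₁ q₂ δ≡1 =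
  let t₁ , t₂ = to T-∧ (from T-≡ δ≡1) in ≡ᵇ⇒≡ _ _ t₁ , ≡ᵇ⇒≡ _ _ t₂

counterδ-complete : ∀ {l} q b q₁ q₂ → toℕ q₁ ≡ toℕ q + bit b → toℕ q₂ ≡ toℕ q + bit b →
                    counterδ l q b q₁ q₂ ≡ true
counterδ-complete q b q₁ q₂ e₁ e₂ = to T-≡ (from T-∧ (≡⇒≡ᵇ _ _ e₁ , ≡⇒≡ᵇ _ _ e₂))

run-counts-ones : ∀ {l x} (r : Run (onesCounter l) x) u → toℕ (ρ r u) ≡ onesAbove x u
run-counts-ones {x = x} r u = go (reverseView u)
  where
  open ≡-Reasoning

  children : ∀ u → toℕ (ρ r (u ∷ʳ L)) ≡ toℕ (ρ r u) + bit (x u)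
                 × toℕ (ρ r (u ∷ʳ R)) ≡ toℕ (ρ r u) + bit (x u)
  children u = counterδ-sound (ρ r u) (x u) (ρ r (u ∷ʳ L)) (ρ r (u ∷ʳ R)) (trans r u)

  child : ∀ u d → toℕ (ρ r (u ∷ʳ d)) ≡ toℕ (ρ r u) + bit (x u)
  child u L = proj₁ (children u)
  child u R = proj₂ (children u)

  go : ∀ {u} → Reverse u → toℕ (ρ r u) ≡ onesAbove x u
  go []               = cong toℕ (root r)
  go (u ∶ rev-u ∶ʳ d) = begin
    toℕ (ρ r (u ∷ʳ d))         ≡⟨ child u d ⟩
    toℕ (ρ r u) + bit (x u)    ≡⟨ cong (_+ bit (x u)) (go rev-u) ⟩
    onesAbove x u + bit (x u)  ≡⟨ onesAbove-∷ʳ x u d ⟨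
    onesAbove x (u ∷ʳ d)       ∎

accepts⇒bounded : ∀ {l x} → Accepts (onesCounter l) x → OnesBounded l x
accepts⇒bounded {l} (r , _) u = subst (_≤ l) (run-counts-ones r u) (≤-pred (toℕ<n (ρ r u)))

bounded⇒accepts : ∀ {l x} → OnesBounded l x → Accepts (onesCounter l) x
bounded⇒accepts {l} {x} bounded =
  run , λ β → 0 , refl , (λ n → n , ≤-refl , refl) , 0 , λ _ _ → z≤n
  where
  state : Node → Fin (suc l)
  state u = fromℕ< (s≤s (bounded u))

  child : ∀ u d → toℕ (state (u ∷ʳ d)) ≡ toℕ (state u) + bit (x u)
  child u d = begin
    toℕ (state (u ∷ʳ d))         ≡⟨ toℕ-fromℕ< _ ⟩
    onesAbove x (u ∷ʳ d)         ≡⟨ onesAbove-∷ʳ x u d ⟩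
    onesAbove x u + bit (x u)    ≡⟨ cong (_+ bit (x u)) (toℕ-fromℕ< _) ⟨
    toℕ (state u) + bit (x u)    ∎
    where open ≡-Reasoning

  run : Run (onesCounter l) x
  run = record
    { ρ     = state
    ; root  = refl
    ; trans = λ u → counterδ-complete (state u) (x u) (state (u ∷ʳ L)) (state (u ∷ʳ R))
                                      (child u L) (child u R)
    }

fact12 : (l : ℕ) → Regular (InL≤ l)
fact12 l = onesCounter l , λ x → mk⇔
  (λ accepts → let bounded = accepts⇒bounded accepts in
               bounded⇒wellFounded bounded , bounded⇒rankMap bounded)
  (λ (_ , rank) → bounded⇒accepts (rankMap⇒bounded rank))
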